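{- Let $t>0$ and let $s_n=\lfloor t\,2^n\rfloor$ for $n\ge1$. Then $S_t(2)=(s_1,s_2,\ldots)$ is complete if and only if $t = \frac{1}{2^k}$ for some integer $k\ge 1$; the same characterization holds for entire completeness.
   Context: For a sequence $S$ of non-negative integers, $P(S)$ is the set of positive integers expressible as a sum of distinct terms of $S$ (each index used at most once). $S$ is complete if $\mathbb{N}\setminus P(S)$ is finite, and entirely complete if $P(S)=\mathbb{N}$, the set of positive integers. $S_t(\alpha)=(s_1,s_2,\ldots)$ with $s_n=\lfloor t\alpha^n\rfloor$. -}

module Defs where

open import Data.Nat using (ℕ; zero; suc; _+_; _*_; _≤_; _<_)
open import Data.Bool using (Bool; true; false)
open import Data.List using (List; map)
open import Data.Nat.ListAction using (sum)
open import Data.List.Relation.Unary.All using (All)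
open import Data.List.Relation.Unary.Unique.Propositional using (Unique)
open import Data.Product using (Σ; ∃; _×_)
open import Data.Sum using (_⊎_)
open import Relation.Binary.PropositionalEquality using (_≡_)
open import Relation.Nullary using (¬_)

-- A non-negative real t is represented by its binary expansion
--   t = m + Σ_{i ≥ 0} b i · 2^{-(i+1)}
-- (integer part m, fractional digit stream b), normalised so that the
-- digit stream is not eventually all 1s (this makes the representation
-- unique: every real t ≥ 0 has exactly one such expansion).
Digits : Set
Digits = ℕ → Bool

bit : Bool → ℕ
bit true  = 1
bit false = 0

Normalised : Digits → Set
Normalised b = ¬ (∃ λ N → ∀ i → N ≤ i → b i ≡ true)

Positive : ℕ → Digits → Set
Positive m b = (0 < m) ⊎ (∃ λ i → b i ≡ true)

-- floorScaled m b n = ⌊ t · 2^n ⌋  for t = m + 0.b₀b₁b₂… (binary)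
floorScaled : ℕ → Digits → ℕ → ℕ
floorScaled m b zero    = m
floorScaled m b (suc n) = 2 * floorScaled m b n + bit (b n)

-- S_t(2): s_n = ⌊ t 2^n ⌋, meaningful for indices n ≥ 1 (index 0 unused)
S2 : ℕ → Digits → ℕ → ℕ
S2 m b n = floorScaled m b n

-- x ∈ P(S): x is a sum of terms s_i over a finite set of distinct indices i ≥ 1
-- (sequences are indexed from 1; s : ℕ → ℕ with s 0 ignored)
InP : (ℕ → ℕ) → ℕ → Set
InP s x = Σ (List ℕ) λ is → All (1 ≤_) is × Unique is × sum (map s is) ≡ x

-- complete: ℕ \ P(S) finite, i.e. all sufficiently large positive integers lie in P(S)
Complete : (ℕ → ℕ) → Set
Complete s = ∃ λ N → ∀ x → 1 ≤ x → N ≤ x → InP s x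

EntirelyComplete : (ℕ → ℕ) → Set
EntirelyComplete s = ∀ x → 1 ≤ x → InP s x

-- t = 1/2^k for some integer k ≥ 1: integer part 0, the only 1-digit is
-- digit index k-1 (weight 2^{-k})
IsInvPow2 : ℕ → Digits → Set
IsInvPow2 m b = ∃ λ k → 1 ≤ k × m ≡ 0 × (∀ i → b i ≡ true → suc i ≡ k) × (∀ i → suc i ≡ k → b i ≡ true)

{-# OPTIONS --safe #-}
-- Write t = m + 0.b₀b₁b₂… in binary, so that s₀ = m and s_{n+1} = 2 sₙ + bₙ.
-- Induction gives s_{n+1} = s₁ + ⋯ + sₙ + 2m + #{i ≤ n : bᵢ = 1}. Once this
-- excess reaches 2 it never drops, and then s₁ + ⋯ + sₙ + 1 is not a subset sum
-- (the indices ≤ n give too little, any larger index too much), so the gaps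
-- never end. Hence completeness forces m = 0 and a single digit 1, at position
-- k - 1 say, i.e. t = 2^{-k}. Conversely for such t the sequence is
-- 0, …, 0, 1, 2, 4, …, and binary expansion represents every integer.
module Submission where

open import Defs
open import Data.Nat using (ℕ; zero; suc; _+_; _*_; _^_; _≤_; _<_; z≤n; s≤s; _≟_; _≤?_; _<?_)
open import Data.Nat.Properties
open import Data.Nat.Tactic.RingSolver using (solve-∀)
open import Algebra.Properties.CommutativeSemigroup +-commutativeSemigroup using (x∙yz≈y∙xz)
open import Data.Nat.ListAction using (sum)
open import Data.Bool using (true; false)
open import Data.Bool.Properties using (¬-not)
open import Data.List using ([]; _∷_; map; filter)
open import Data.List.Properties using (filter-all; filter-accept; filter-reject; map-∘; map-cong)
open import Data.List.Relation.Unary.All as All using (All; []; _∷_; all?)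
import Data.List.Relation.Unary.All.Properties as All
open import Data.List.Relation.Unary.Any as Any using (Any; here; there)
open import Data.List.Relation.Unary.Unique.Propositional using (Unique)
open import Data.List.Relation.Unary.AllPairs using ([]; _∷_)
import Data.List.Relation.Unary.Unique.Propositional.Properties as Unique
open import Data.Product using (∃; _×_; _,_)
open import Data.Sum using (inj₁; inj₂)
open import Function.Base using (_∘_)
open import Function.Bundles using (_⇔_; mk⇔)
open import Relation.Binary.Definitions using (tri<; tri≈; tri>)
open import Relation.Binary.PropositionalEquality
  using (_≡_; _≢_; refl; sym; trans; cong; subst; ≢-sym; module ≡-Reasoning)
open import Relation.Nullary using (¬_; Dec; yes; no; ¬?; contradiction)

partialSum : (ℕ → ℕ) → ℕ → ℕ
partialSum s zero    = 0
partialSum s (suc n) = partialSum s n + s (suc n)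

_≢?_ : (x v : ℕ) → Dec (x ≢ v)
x ≢? v = ¬? (x ≟ v)

sum-map-≤-+-filter≢ : ∀ (f : ℕ → ℕ) v {xs} → Unique xs →
  sum (map f xs) ≤ f v + sum (map f (filter (_≢? v) xs))
sum-map-≤-+-filter≢ f v {[]}     []           = z≤n
sum-map-≤-+-filter≢ f v {x ∷ xs} (x∉xs ∷ xs!) with x ≟ v
... | yes refl = ≤-reflexive (cong (λ ys → f x + sum (map f ys)) (begin
  xs                      ≡⟨ filter-all (_≢? x) (All.map ≢-sym x∉xs) ⟨
  filter (_≢? x) xs       ≡⟨ filter-reject (_≢? x) (λ x≢x → x≢x refl) ⟨
  filter (_≢? x) (x ∷ xs) ∎))
  where open ≡-Reasoning
... | no x≢v   = begin
  f x + sum (map f xs)                        ≤⟨ +-monoʳ-≤ (f x) (sum-map-≤-+-filter≢ f v xs!) ⟩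
  f x + (f v + rest)                          ≡⟨ x∙yz≈y∙xz (f x) (f v) rest ⟩
  f v + (f x + rest)
    ≡⟨ cong (λ ys → f v + sum (map f ys)) (filter-accept (_≢? v) x≢v) ⟨
  f v + sum (map f (filter (_≢? v) (x ∷ xs))) ∎
  where
  open ≤-Reasoning
  rest : ℕ
  rest = sum (map f (filter (_≢? v) xs))

sum-map-≤-partialSum : ∀ (s : ℕ → ℕ) n {is} → Unique is →
  All (1 ≤_) is → All (_≤ n) is → sum (map s is) ≤ partialSum s n
sum-map-≤-partialSum s zero    {[]}    _ _ _ = z≤n
sum-map-≤-partialSum s zero    {i ∷ _} _ (1≤i ∷ _) (i≤0 ∷ _) = contradiction (≤-trans 1≤i i≤0) λ ()
sum-map-≤-partialSum s (suc n) {is} is! 1≤is is≤1+n = begin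
  sum (map s is)                       ≤⟨ sum-map-≤-+-filter≢ s (suc n) is! ⟩
  s (suc n) + sum (map s (filter (_≢? suc n) is))
    ≤⟨ +-monoʳ-≤ (s (suc n)) (sum-map-≤-partialSum s n
         (Unique.filter⁺ (_≢? suc n) is!) (All.filter⁺ (_≢? suc n) 1≤is) rest≤n) ⟩
  s (suc n) + partialSum s n           ≡⟨ +-comm (s (suc n)) (partialSum s n) ⟩
  partialSum s (suc n)                 ∎
  where
  open ≤-Reasoning
  rest≤n : All (_≤ n) (filter (_≢? suc n) is)
  rest≤n = All.zipWith (λ (i≢1+n , i≤1+n) → ≤-pred (≤∧≢⇒< i≤1+n i≢1+n))
             (All.all-filter (_≢? suc n) is , All.filter⁺ (_≢? suc n) is≤1+n)

Any-≤⇒≤-sum-map : ∀ (f : ℕ → ℕ) {c is} → Any (λ i → c ≤ f i) is → c ≤ sum (map f is)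
Any-≤⇒≤-sum-map f {is = i ∷ is} (here c≤fi)  = ≤-trans c≤fi (m≤m+n (f i) _)
Any-≤⇒≤-sum-map f {is = i ∷ is} (there c≤Σ) = ≤-trans (Any-≤⇒≤-sum-map f c≤Σ) (m≤n+m _ (f i))

superincreasing⇒¬InP : ∀ {s} n → (∀ j → n < j → 2 + partialSum s n ≤ s j) →
  ¬ InP s (suc (partialSum s n))
superincreasing⇒¬InP {s} n gap (is , 1≤is , is! , sum≡) with all? (_≤? n) is
... | yes is≤n = <⇒≱ (≤-reflexive (sym sum≡)) (sum-map-≤-partialSum s n is! 1≤is is≤n)
... | no ¬is≤n = <⇒≱ (≤-reflexive (cong suc sum≡)) (Any-≤⇒≤-sum-map s
        (Any.map (gap _ ∘ ≰⇒>) (All.¬All⇒Any¬ (_≤? n) is ¬is≤n)))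

eventuallySuperincreasing⇒¬Complete : ∀ {s} n₀ →
  (∀ n → n₀ ≤ n → 2 + partialSum s n ≤ s (suc n)) → ¬ Complete s
-- Past n₀ each term exceeds the sum of all earlier ones, so the missing value
-- s₁ + ⋯ + s_{N+n₀} + 1 is at least N.
eventuallySuperincreasing⇒¬Complete {s} n₀ step (N , complete) =
  superincreasing⇒¬InP (N + n₀) (gap (m≤n+m n₀ N))
    (complete _ (s≤s z≤n) (m≤n⇒m≤1+n (growth N)))
  where
  open ≤-Reasoning
  gap : ∀ {n} → n₀ ≤ n → ∀ j → n < j → 2 + partialSum s n ≤ s j
  gap {n} n₀≤n (suc j) (s≤s n≤j) with m≤n⇒m<n∨m≡n n≤j
  ... | inj₂ refl = step n n₀≤n
  ... | inj₁ n<j@(s≤s {n = i} _) = begin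
    2 + partialSum s n         ≤⟨ gap n₀≤n j n<j ⟩
    s (suc i)                  ≤⟨ m≤n+m (s (suc i)) (partialSum s i) ⟩
    partialSum s (suc i)       ≤⟨ m≤n+m (partialSum s (suc i)) 2 ⟩
    2 + partialSum s (suc i)   ≤⟨ step (suc i) (≤-trans n₀≤n (<⇒≤ n<j)) ⟩
    s (suc (suc i))            ∎
  growth : ∀ N → N ≤ partialSum s (N + n₀)
  growth zero    = z≤n
  growth (suc N) = begin
    suc N                                    ≡⟨ +-comm 1 N ⟩
    N + 1                                    ≤⟨ +-mono-≤ (growth N)
                                                  (≤-trans (s≤s z≤n) (step (N + n₀) (m≤n+m n₀ N))) ⟩
    partialSum s (N + n₀) + s (suc N + n₀)   ∎

n<2^n : ∀ n → n < 2 ^ n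
n<2^n zero    = s≤s z≤n
n<2^n (suc n) = begin-strict
  suc n            <⟨ +-mono-≤ (m^n>0 2 n) (n<2^n n) ⟩
  2 ^ n + 2 ^ n    ≡⟨ cong (2 ^ n +_) (+-identityʳ (2 ^ n)) ⟨
  2 ^ suc n        ∎
  where open ≤-Reasoning

binaryExpansion-< : ∀ n {x} → x < 2 ^ n →
  ∃ λ js → All (_< n) js × Unique js × sum (map (2 ^_) js) ≡ x
binaryExpansion-< zero    {zero}  _         = [] , [] , [] , refl
binaryExpansion-< zero    {suc _} (s≤s ())
binaryExpansion-< (suc n) {x} x<2^[1+n] with x <? 2 ^ n
... | yes x<2^n =
  let js , js<n , js! , sum≡x = binaryExpansion-< n x<2^n
  in  js , All.map m<n⇒m<1+n js<n , js! , sum≡x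
... | no x≮2^n =
  let y , 2^n+y≡x = m≤n⇒∃[o]m+o≡n (≮⇒≥ x≮2^n)
      y<2^n = +-cancelˡ-< (2 ^ n) y (2 ^ n) (begin-strict
        2 ^ n + y       ≡⟨ 2^n+y≡x ⟩
        x               <⟨ x<2^[1+n] ⟩
        2 ^ suc n       ≡⟨ cong (2 ^ n +_) (+-identityʳ (2 ^ n)) ⟩
        2 ^ n + 2 ^ n   ∎)
      js , js<n , js! , sum≡y = binaryExpansion-< n y<2^n
  in  n ∷ js , ≤-refl ∷ All.map m<n⇒m<1+n js<n ,
      All.map (λ j<n → <⇒≢ j<n ∘ sym) js<n ∷ js! ,
      trans (cong (2 ^ n +_) sum≡y) 2^n+y≡x
  where open ≤-Reasoning

binaryExpansion : ∀ x → ∃ λ js → Unique js × sum (map (2 ^_) js) ≡ x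
binaryExpansion x =
  let js , _ , js! , sum≡x = binaryExpansion-< x (n<2^n x) in js , js! , sum≡x

shiftedPowersOfTwo⇒EntirelyComplete : ∀ {s} k → 1 ≤ k → (∀ j → s (j + k) ≡ 2 ^ j) →
  EntirelyComplete s
shiftedPowersOfTwo⇒EntirelyComplete {s} k 1≤k s[j+k]≡2^j x _ =
  let js , js! , sum≡x = binaryExpansion x
  in  map (_+ k) js ,
      All.map⁺ (All.universal (λ j → ≤-trans 1≤k (m≤n+m k j)) js) ,
      Unique.map⁺ (+-cancelʳ-≡ k _ _) js! ,
      (begin
        sum (map s (map (_+ k) js))  ≡⟨ cong sum (map-∘ js) ⟨
        sum (map (s ∘ (_+ k)) js)    ≡⟨ cong sum (map-cong s[j+k]≡2^j js) ⟩
        sum (map (2 ^_) js)          ≡⟨ sum≡x ⟩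
        x                            ∎)
  where open ≡-Reasoning

countOnes : Digits → ℕ → ℕ
countOnes b zero    = 0
countOnes b (suc n) = countOnes b n + bit (b n)

countOnes-mono : ∀ b {i j} → i ≤ j → countOnes b i ≤ countOnes b j
countOnes-mono b {j = zero}  z≤n = z≤n
countOnes-mono b {i} {suc j} i≤1+j with m≤n⇒m<n∨m≡n i≤1+j
... | inj₁ (s≤s i≤j) = ≤-trans (countOnes-mono b i≤j) (m≤m+n (countOnes b j) _)
... | inj₂ refl      = ≤-refl

2≤countOnes : ∀ b {i j} → b i ≡ true → b j ≡ true → i < j → 2 ≤ countOnes b (suc j)
2≤countOnes b {i} {j} bᵢ bⱼ i<j =
  +-mono-≤ (≤-trans one≤countOnes[1+i] (countOnes-mono b i<j)) (≤-reflexive (cong bit (sym bⱼ)))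
  where
  one≤countOnes[1+i] : 1 ≤ countOnes b (suc i)
  one≤countOnes[1+i] = ≤-trans (≤-reflexive (cong bit (sym bᵢ))) (m≤n+m _ (countOnes b i))

countOnes≤1⇒≡ : ∀ b → (∀ n → countOnes b (suc n) ≤ 1) →
  ∀ {i j} → b i ≡ true → b j ≡ true → i ≡ j
countOnes≤1⇒≡ b ≤1 {i} {j} bᵢ bⱼ with <-cmp i j
... | tri< i<j _ _ = contradiction (≤1 j) (<⇒≱ (2≤countOnes b bᵢ bⱼ i<j))
... | tri≈ _ i≡j _ = i≡j
... | tri> _ _ j<i = contradiction (≤1 i) (<⇒≱ (2≤countOnes b bⱼ bᵢ j<i))

excess : ℕ → Digits → ℕ → ℕ
excess m b n = 2 * m + countOnes b (suc n)

floorScaled-suc : ∀ m b n →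
  floorScaled m b (suc n) ≡ partialSum (floorScaled m b) n + excess m b n
floorScaled-suc m b zero    = refl
floorScaled-suc m b (suc n) = begin
  2 * s (suc n) + d                         ≡⟨ cong (λ x → 2 * x + d) (floorScaled-suc m b n) ⟩
  2 * (partialSum s n + e) + d              ≡⟨ 2[x+y]+z≡x+[x+y]+[y+z] (partialSum s n) e d ⟩
  partialSum s n + (partialSum s n + e) + (e + d)
    ≡⟨ cong (λ x → partialSum s n + x + (e + d)) (floorScaled-suc m b n) ⟨
  partialSum s (suc n) + (e + d)
    ≡⟨ cong (partialSum s (suc n) +_) (+-assoc (2 * m) _ d) ⟩
  partialSum s (suc n) + excess m b (suc n) ∎
  where
  open ≡-Reasoning
  s : ℕ → ℕ
  s = floorScaled m b
  e d : ℕ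
  e = excess m b n
  d = bit (b (suc n))
  2[x+y]+z≡x+[x+y]+[y+z] : ∀ x y z → 2 * (x + y) + z ≡ x + (x + y) + (y + z)
  2[x+y]+z≡x+[x+y]+[y+z] = solve-∀

2≤excess⇒¬Complete : ∀ m b n₀ → 2 ≤ excess m b n₀ → ¬ Complete (floorScaled m b)
2≤excess⇒¬Complete m b n₀ 2≤excess = eventuallySuperincreasing⇒¬Complete n₀ λ n n₀≤n → begin
  2 + partialSum s n
    ≤⟨ +-monoˡ-≤ (partialSum s n)
         (≤-trans 2≤excess (+-monoʳ-≤ (2 * m) (countOnes-mono b (s≤s n₀≤n)))) ⟩
  excess m b n + partialSum s n      ≡⟨ +-comm (excess m b n) (partialSum s n) ⟩
  partialSum s n + excess m b n      ≡⟨ floorScaled-suc m b n ⟨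
  s (suc n)                          ∎
  where
  open ≤-Reasoning
  s : ℕ → ℕ
  s = floorScaled m b

Complete⇒IsInvPow2 : ∀ {m b} → Positive m b → Complete (floorScaled m b) → IsInvPow2 m b
Complete⇒IsInvPow2 {m} {b} positive complete with positive
... | inj₁ 0<m = contradiction complete (2≤excess⇒¬Complete m b 0
                   (≤-trans (*-monoʳ-≤ 2 0<m) (m≤m+n (2 * m) _)))
... | inj₂ (i , bᵢ) = suc i , s≤s z≤n , m≡0 ,
  (λ j bⱼ → cong suc (countOnes≤1⇒≡ b countOnes≤1 bⱼ bᵢ)) ,
  (λ j 1+j≡1+i → subst (λ j → b j ≡ true) (suc-injective (sym 1+j≡1+i)) bᵢ)
  where
  excess≤1 : ∀ n → excess m b n ≤ 1
  excess≤1 n = ≮⇒≥ λ 1<excess → 2≤excess⇒¬Complete m b n 1<excess complete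
  m≡0 : m ≡ 0
  m≡0 = n<1⇒n≡0 (*-cancelˡ-< 2 m 1 (s≤s (m+n≤o⇒m≤o (2 * m) (excess≤1 0))))
  countOnes≤1 : ∀ n → countOnes b (suc n) ≤ 1
  countOnes≤1 n = m+n≤o⇒n≤o (2 * m) (excess≤1 n)

module _ {b : Digits} {k : ℕ} (onlyAt : ∀ i → b i ≡ true → suc i ≡ suc k) where

  digit-false : ∀ {i} → i ≢ k → b i ≡ false
  digit-false i≢k = ¬-not λ bᵢ → i≢k (suc-injective (onlyAt _ bᵢ))

  floorScaled[n≤k]≡0 : ∀ {n} → n ≤ k → floorScaled 0 b n ≡ 0
  floorScaled[n≤k]≡0 {zero}  _    = refl
  floorScaled[n≤k]≡0 {suc n} n<k
    rewrite floorScaled[n≤k]≡0 (<⇒≤ n<k) | digit-false (<⇒≢ n<k) = refl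

  floorScaled[j+1+k]≡2^j : b k ≡ true → ∀ j → floorScaled 0 b (j + suc k) ≡ 2 ^ j
  floorScaled[j+1+k]≡2^j bₖ zero    rewrite floorScaled[n≤k]≡0 ≤-refl | bₖ = refl
  floorScaled[j+1+k]≡2^j bₖ (suc j)
    rewrite floorScaled[j+1+k]≡2^j bₖ j | digit-false (>⇒≢ (m≤n+m (suc k) j)) =
      +-identityʳ (2 * 2 ^ j)

IsInvPow2⇒EntirelyComplete : ∀ {m b} → IsInvPow2 m b → EntirelyComplete (floorScaled m b)
IsInvPow2⇒EntirelyComplete (suc k , _ , refl , onlyAt , at) =
  shiftedPowersOfTwo⇒EntirelyComplete (suc k) (s≤s z≤n) (floorScaled[j+1+k]≡2^j onlyAt (at k refl))

EntirelyComplete⇒Complete : ∀ {s} → EntirelyComplete s → Complete s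
EntirelyComplete⇒Complete entirelyComplete = 0 , λ x 1≤x _ → entirelyComplete x 1≤x

mainTheorem4 : (m : ℕ) (b : Digits) → Normalised b → Positive m b →
    (Complete (S2 m b) ⇔ IsInvPow2 m b) × (EntirelyComplete (S2 m b) ⇔ IsInvPow2 m b)
mainTheorem4 m b _ positive =
  mk⇔ (Complete⇒IsInvPow2 positive) (EntirelyComplete⇒Complete ∘ IsInvPow2⇒EntirelyComplete) ,
  mk⇔ (Complete⇒IsInvPow2 positive ∘ EntirelyComplete⇒Complete) IsInvPow2⇒EntirelyComplete
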